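{- Let $k\ge2$, let $B=(1,b_2,\dots,b_k)$ be positive integers with $1<b_2<\cdots<b_k$, let $c=\max\{O_B(r)\mid 0\le r\le b_k-1\}$ and assume $c\ge 2$; let $u=\max\left\{c-1,\left\lceil\frac{(c-1)b_{k-1}}{b_k-b_{k-1}}\right\rceil\right\}$. Let $h,d$ be positive integers with $h\ge\left\lceil\frac{d}{u+c-1}\right\rceil$, and for positive integers $a$ with $\gcd(a,d)=1$ let $A(a)=(a,ha+d,ha+db_2,\dots,ha+db_k)$. Then there exist two sequences of nonnegative integers $W_B=(w_j)_{0\le j\le b_k-1}$ and $R_B=(r_j)_{0\le j\le b_k-1}$ such that for all $a\ge (u+c-1)b_k$ with $\gcd(a,d)=1$, $$g(A(a))=(w_jh-1)a+r_jd+(ha+b_kd)\left(\left\lfloor\frac{a}{b_k}\right\rfloor-u-c+1\right),\quad\text{where } a\equiv j \pmod{b_k}.$$ Moreover, $W_B$ and $R_B$ are both (weakly) increasing in $j$, and $w_{b_k-1}-w_0\le 1$.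
   Context: For $M\in\mathbb{N}$, $O_B(M):=\min\{\sum_{i=1}^k x_i \mid \sum_{i=1}^k b_ix_i=M,\ x_i\in\mathbb{N}\}$ with $b_1=1$. For positive integers $a_1,\dots,a_n$ with $\gcd=1$, the Frobenius number $g(a_1,\dots,a_n)$ is the largest integer not representable as $\sum x_ia_i$ with $x_i\in\mathbb{N}$ (nonnegative integers). -}

module Defs where

open import Data.Nat using (ℕ; zero; suc; _+_; _*_; _∸_; _≤_; _<_)
open import Data.Nat.DivMod using (_/_; _%_)
open import Data.Fin using (Fin; zero; suc)
open import Data.Integer as ℤ using (ℤ; +_)
open import Data.Product using (Σ; _×_)
open import Relation.Binary.PropositionalEquality using (_≡_)
open import Relation.Nullary using (¬_)

sumFin : {n : ℕ} → (Fin n → ℕ) → ℕ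
sumFin {zero}  f = 0
sumFin {suc n} f = f zero + sumFin (λ i → f (suc i))

-- floor / ceiling division (divisor 0 gives 0; only used with positive divisors)
floorDiv : ℕ → ℕ → ℕ
floorDiv x zero    = 0
floorDiv x (suc y) = x / suc y

modN : ℕ → ℕ → ℕ
modN x zero    = x
modN x (suc y) = x % suc y

ceilDiv : ℕ → ℕ → ℕ
ceilDiv x zero    = 0
ceilDiv x (suc y) = (x + y) / suc y

IsOB : {k : ℕ} → (Fin k → ℕ) → ℕ → ℕ → Set
IsOB b M o =
  Σ (Fin _ → ℕ) (λ x → sumFin (λ i → b i * x i) ≡ M × sumFin x ≡ o)
  × ((x : Fin _ → ℕ) → sumFin (λ i → b i * x i) ≡ M → o ≤ sumFin x)

IsMaxOB : {k : ℕ} → (Fin k → ℕ) → ℕ → ℕ → Set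
IsMaxOB b bk c =
  Σ ℕ (λ r → r < bk × IsOB b r c)
  × ((r o : ℕ) → r < bk → IsOB b r o → o ≤ c)

Representable : {n : ℕ} → (Fin n → ℕ) → ℤ → Set
Representable a z = Σ (Fin _ → ℕ) (λ x → z ≡ + sumFin (λ i → x i * a i))

IsFrobenius : {n : ℕ} → (Fin n → ℕ) → ℤ → Set
IsFrobenius a g = ¬ Representable a g × ((z : ℤ) → g ℤ.< z → Representable a z)

Aseq : {k : ℕ} → (Fin k → ℕ) → ℕ → ℕ → ℕ → Fin (suc k) → ℕ
Aseq b h d a zero    = a
Aseq b h d a (suc i) = h * a + d * b i

-- Write an element of the semigroup of A(a) as x₀·a + Σ yᵢ·(h·a + d·bᵢ) = x₀·a + h·a·Σyᵢ + d·M with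
-- M = Σ bᵢ·yᵢ.  As gcd(a, d) = 1, d·M runs through all classes mod a for M < a, and the least element
-- reachable through the value M is V(M) = h·a·O_B(M) + d·M; for a ≥ (u + c − 1)·bₖ larger values M do
-- no better, so g(A(a)) = V(x) − a where x is the last maximiser of O_B on [0, a) (the condition on h
-- makes d·bₖ ≤ h·a, so a larger O_B always wins).  Beyond u·bₖ an optimal representation must use the
-- coin bₖ, whence O_B(M + bₖ) = O_B(M) + 1; therefore the last maximiser for a + bₖ is x + bₖ, and x and
-- O_B(x) are quasi-periodic in a.  Reading them off at a = (u + c − 1)·bₖ + j gives r_j and w_j; their
-- monotonicity, and w_{bₖ−1} ≤ w₀ + 1, come from the monotonicity of the last maximiser in a.
module Submission where

open import Defs
open import Data.Nat
  using (ℕ; zero; suc; _+_; _*_; _∸_; _≤_; _<_; _⊔_; z≤n; s≤s; _≤?_; _<?_; NonZero; >-nonZero; >-nonZero⁻¹; pred)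
open import Data.Nat.Properties
open import Data.Nat.DivMod using (_/_; _%_; m≡m%n+[m/n]*n; m%n<n)
open import Data.Nat.Divisibility using (_∣_; ∣⇒≤; ∣m+n∣m⇒∣n; m∣m*n)
open import Data.Nat.GCD using (gcd; module Bézout)
open import Data.Nat.Coprimality using (Coprime; gcd≡1⇒coprime; coprime-divisor; coprime-Bézout)
open import Data.Nat.Induction using (<-rec)
open import Data.Nat.Tactic.RingSolver using (solve-∀; solve)
open import Data.Fin using (Fin; zero; suc; fromℕ; inject₁; toℕ)
  renaming (_<_ to _<ᶠ_; _≟_ to _≟ᶠ_)
open import Data.Fin.Properties using (toℕ-injective; toℕ≤pred[n]; toℕ-fromℕ; toℕ-inject₁)
open import Data.List using ([]; _∷_)
open import Data.Product using (Σ; _×_; _,_; proj₁; proj₂; ∃)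
open import Data.Sum using (_⊎_; inj₁; inj₂)
open import Data.Empty using (⊥; ⊥-elim)
open import Relation.Nullary using (¬_; yes; no)
open import Relation.Binary.PropositionalEquality
open import Relation.Binary.Definitions using (tri<; tri≈; tri>)
open import Algebra.Properties.CommutativeSemigroup +-commutativeSemigroup using (interchange)

sumFin-cong : ∀ {n} {f g : Fin n → ℕ} → (∀ i → f i ≡ g i) → sumFin f ≡ sumFin g
sumFin-cong {zero}  f≗g = refl
sumFin-cong {suc n} f≗g = cong₂ _+_ (f≗g zero) (sumFin-cong (λ i → f≗g (suc i)))

sumFin-+ : ∀ {n} (f g : Fin n → ℕ) → sumFin (λ i → f i + g i) ≡ sumFin f + sumFin g
sumFin-+ {zero}  f g = refl
sumFin-+ {suc n} f g =
  trans (cong (f zero + g zero +_) (sumFin-+ (λ i → f (suc i)) (λ i → g (suc i))))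
        (interchange (f zero) (g zero) _ _)

sumFin-*ˡ : ∀ {n} k (f : Fin n → ℕ) → sumFin (λ i → k * f i) ≡ k * sumFin f
sumFin-*ˡ {zero}  k f = sym (*-zeroʳ k)
sumFin-*ˡ {suc n} k f =
  trans (cong (k * f zero +_) (sumFin-*ˡ k (λ i → f (suc i)))) (sym (*-distribˡ-+ k (f zero) _))

sumFin-mono : ∀ {n} {f g : Fin n → ℕ} → (∀ i → f i ≤ g i) → sumFin f ≤ sumFin g
sumFin-mono {zero}  f≤g = z≤n
sumFin-mono {suc n} f≤g = +-mono-≤ (f≤g zero) (sumFin-mono (λ i → f≤g (suc i)))

sumFin-zero : ∀ n → sumFin {n} (λ _ → 0) ≡ 0
sumFin-zero zero    = refl
sumFin-zero (suc n) = sumFin-zero n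

f≤sumFin : ∀ {n} (f : Fin n → ℕ) i → f i ≤ sumFin f
f≤sumFin f zero    = m≤m+n _ _
f≤sumFin f (suc i) = ≤-trans (f≤sumFin (λ j → f (suc j)) i) (m≤n+m _ (f zero))

0<sumFin⇒∃0< : ∀ {n} (f : Fin n → ℕ) → 0 < sumFin f → ∃ λ i → 0 < f i
0<sumFin⇒∃0< {suc n} f 0<Σf with f zero in eq
... | suc _ = zero , subst (0 <_) (sym eq) (s≤s z≤n)
... | zero  = let i , 0<fi = 0<sumFin⇒∃0< (λ j → f (suc j)) 0<Σf in suc i , 0<fi

δ : ∀ {n} → Fin n → Fin n → ℕ
δ zero    zero    = 1
δ zero    (suc _) = 0
δ (suc _) zero    = 0
δ (suc i) (suc j) = δ i j

sumFin-*δ : ∀ {n} (g : Fin n → ℕ) i → sumFin (λ j → g j * δ i j) ≡ g i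
sumFin-*δ {suc n} g zero = begin
  g zero * 1 + sumFin (λ j → g (suc j) * 0)
    ≡⟨ cong₂ _+_ (*-identityʳ (g zero)) (sumFin-cong (λ j → *-zeroʳ (g (suc j)))) ⟩
  g zero + sumFin {n} (λ _ → 0)            ≡⟨ cong (g zero +_) (sumFin-zero n) ⟩
  g zero + 0                                ≡⟨ +-identityʳ (g zero) ⟩
  g zero                                    ∎
  where open ≡-Reasoning
sumFin-*δ {suc n} g (suc i) =
  trans (cong (_+ sumFin (λ j → g (suc j) * δ i j)) (*-zeroʳ (g zero))) (sumFin-*δ (λ j → g (suc j)) i)

∸δ+δ : ∀ {n} (y : Fin n → ℕ) i → 0 < y i → ∀ j → y j ∸ δ i j + δ i j ≡ y j
∸δ+δ y zero    0<yi zero    = m∸n+n≡m 0<yi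
∸δ+δ y zero    0<yi (suc j) = +-identityʳ _
∸δ+δ y (suc i) 0<yi zero    = +-identityʳ _
∸δ+δ y (suc i) 0<yi (suc j) = ∸δ+δ (λ k → y (suc k)) i 0<yi j

argmin : ∀ {n} (f : Fin (suc n) → ℕ) → ∃ λ i → ∀ j → f i ≤ f j
argmin {zero}  f = zero , λ { zero → ≤-refl }
argmin {suc n} f with argmin (λ j → f (suc j))
... | i , min with f zero ≤? f (suc i)
...   | yes f0≤ = zero  , λ { zero → ≤-refl ; (suc j) → ≤-trans f0≤ (min j) }
...   | no  f0≰ = suc i , λ { zero → <⇒≤ (≰⇒> f0≰) ; (suc j) → min j }

module CoinProblem {n : ℕ} (b : Fin (suc n) → ℕ) (b₀≡1 : b zero ≡ 1) (b-pos : ∀ i → 0 < b i) where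

  value : (Fin (suc n) → ℕ) → ℕ
  value y = sumFin (λ i → b i * y i)

  addCoin removeCoin : (Fin (suc n) → ℕ) → Fin (suc n) → Fin (suc n) → ℕ
  addCoin    y i j = y j + δ i j
  removeCoin y i j = y j ∸ δ i j

  value-addCoin : ∀ y i → value (addCoin y i) ≡ value y + b i
  value-addCoin y i = begin
    sumFin (λ j → b j * (y j + δ i j))         ≡⟨ sumFin-cong (λ j → *-distribˡ-+ (b j) (y j) (δ i j)) ⟩
    sumFin (λ j → b j * y j + b j * δ i j)     ≡⟨ sumFin-+ (λ j → b j * y j) (λ j → b j * δ i j) ⟩
    value y + sumFin (λ j → b j * δ i j)       ≡⟨ cong (value y +_) (sumFin-*δ b i) ⟩
    value y + b i                              ∎
    where open ≡-Reasoning

  sumFin-addCoin : ∀ y i → sumFin (addCoin y i) ≡ suc (sumFin y)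
  sumFin-addCoin y i = begin
    sumFin (λ j → y j + δ i j)          ≡⟨ sumFin-+ y (δ i) ⟩
    sumFin y + sumFin (δ i)             ≡⟨ cong (sumFin y +_) (sumFin-cong (λ j → sym (*-identityˡ (δ i j)))) ⟩
    sumFin y + sumFin (λ j → 1 * δ i j) ≡⟨ cong (sumFin y +_) (sumFin-*δ (λ _ → 1) i) ⟩
    sumFin y + 1                        ≡⟨ +-comm (sumFin y) 1 ⟩
    suc (sumFin y)                      ∎
    where open ≡-Reasoning

  value-removeCoin : ∀ y i → 0 < y i → value (removeCoin y i) + b i ≡ value y
  value-removeCoin y i 0<yi =
    trans (sym (value-addCoin (removeCoin y i) i)) (sumFin-cong (λ j → cong (b j *_) (∸δ+δ y i 0<yi j)))

  sumFin-removeCoin : ∀ y i → 0 < y i → suc (sumFin (removeCoin y i)) ≡ sumFin y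
  sumFin-removeCoin y i 0<yi =
    trans (sym (sumFin-addCoin (removeCoin y i) i)) (sumFin-cong (∸δ+δ y i 0<yi))

  value-removeCoin-≡∸ : ∀ y i N → value y ≡ N → 0 < y i → value (removeCoin y i) ≡ N ∸ b i
  value-removeCoin-≡∸ y i N y↦N 0<yi =
    trans (sym (m+n∸n≡m _ (b i))) (cong (_∸ b i) (trans (value-removeCoin y i 0<yi) y↦N))

  value-≤ : ∀ B y → (∀ i → b i * y i ≤ B * y i) → value y ≤ B * sumFin y
  value-≤ B y b≤B = ≤-trans (sumFin-mono b≤B) (≤-reflexive (sumFin-*ˡ B y))

  OptimalCount : ℕ → Set
  OptimalCount M = Σ ℕ (IsOB b M)

  -- count > M encodes that coin i does not fit into M.
  record CountUsing (M : ℕ) (i : Fin (suc n)) : Set where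
    field
      count    : ℕ
      attained : M < count ⊎ Σ (Fin (suc n) → ℕ) (λ y → value y ≡ M × sumFin y ≡ count)
      minimal  : ∀ y → value y ≡ M → 0 < y i → count ≤ sumFin y
  open CountUsing

  countUsing : ∀ M → (∀ M′ → M′ < M → OptimalCount M′) → ∀ i → CountUsing M i
  countUsing M optimal< i with b i ≤? M
  ... | no bi≰M = record
    { count    = suc M
    ; attained = inj₁ ≤-refl
    ; minimal  = λ y y↦M 0<yi → ⊥-elim (bi≰M (subst (b i ≤_) y↦M
                    (≤-trans (m≤m*n (b i) (y i) {{>-nonZero 0<yi}}) (f≤sumFin (λ j → b j * y j) i))))
    }
  ... | yes bi≤M = record
    { count    = suc o
    ; attained = inj₂ (addCoin x i , value-x+i , trans (sumFin-addCoin x i) (cong suc Σx≡o))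
    ; minimal  = λ y y↦M 0<yi → subst (suc o ≤_) (sumFin-removeCoin y i 0<yi)
                   (s≤s (o-min (removeCoin y i) (value-removeCoin-≡∸ y i M y↦M 0<yi)))
    }
    where
      o,optimal = optimal< (M ∸ b i) (∸-monoʳ-< {o = 0} (b-pos i) bi≤M)
      o = proj₁ o,optimal
      optimal = proj₂ o,optimal
      x = proj₁ (proj₁ optimal)
      Σx≡o = proj₂ (proj₂ (proj₁ optimal))
      o-min = proj₂ optimal
      value-x+i : value (addCoin x i) ≡ M
      value-x+i = trans (value-addCoin x i)
                        (trans (cong (_+ b i) (proj₁ (proj₂ (proj₁ optimal)))) (m∸n+n≡m bi≤M))

  onlyOnes : ℕ → Fin (suc n) → ℕ
  onlyOnes M zero    = M
  onlyOnes M (suc _) = 0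

  value-onlyOnes : ∀ M → value (onlyOnes M) ≡ M
  value-onlyOnes M = begin
    b zero * M + sumFin (λ j → b (suc j) * 0)
      ≡⟨ cong₂ _+_ (cong (_* M) b₀≡1) (sumFin-cong (λ j → *-zeroʳ (b (suc j)))) ⟩
    1 * M + sumFin {n} (λ _ → 0)              ≡⟨ cong₂ _+_ (*-identityˡ M) (sumFin-zero n) ⟩
    M + 0                                      ≡⟨ +-identityʳ M ⟩
    M                                          ∎
    where open ≡-Reasoning

  sumFin-onlyOnes : ∀ M → sumFin (onlyOnes M) ≡ M
  sumFin-onlyOnes M = trans (cong (M +_) (sumFin-zero n)) (+-identityʳ M)

  -- The optimum for M > 0 is 1 + O(M − b i) for the best coin i; coin 1 shows it is at most M.
  optimalCount-step : ∀ M → (∀ M′ → M′ < M → OptimalCount M′) → OptimalCount M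
  optimalCount-step zero _ =
    0 , ((λ _ → 0) , trans (sumFin-cong (λ j → *-zeroʳ (b j))) (sumFin-zero (suc n)) , sumFin-zero (suc n))
      , λ _ _ → z≤n
  optimalCount-step (suc M) optimal< = count (C i*) , attained* , minimal*
    where
      C = countUsing (suc M) optimal<
      i*,min = argmin (λ i → count (C i))
      i* = proj₁ i*,min
      i*-min = proj₂ i*,min
      count₀≤ : count (C zero) ≤ suc M
      count₀≤ = subst (count (C zero) ≤_) (sumFin-onlyOnes (suc M))
                  (minimal (C zero) (onlyOnes (suc M)) (value-onlyOnes (suc M)) (s≤s z≤n))
      attained* : Σ (Fin (suc n) → ℕ) (λ x → value x ≡ suc M × sumFin x ≡ count (C i*))
      attained* with attained (C i*)
      ... | inj₁ M<count = ⊥-elim (<⇒≱ M<count (≤-trans (i*-min zero) count₀≤))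
      ... | inj₂ rep     = rep
      minimal* : ∀ y → value y ≡ suc M → count (C i*) ≤ sumFin y
      minimal* y y↦M with 0<sumFin⇒∃0< (λ j → b j * y j) (subst (0 <_) (sym y↦M) (s≤s z≤n))
      ... | j , 0<bjyj = ≤-trans (i*-min j)
                           (minimal (C j) y y↦M (>-nonZero⁻¹ (y j) {{m*n≢0⇒n≢0 (b j) {{>-nonZero 0<bjyj}}}}))

  optimalCount : ∀ M → OptimalCount M
  optimalCount = <-rec OptimalCount (λ M rec → optimalCount-step M (λ M′ → rec {M′}))

  O : ℕ → ℕ
  O M = proj₁ (optimalCount M)

  O-attained : ∀ M → Σ (Fin (suc n) → ℕ) (λ x → value x ≡ M × sumFin x ≡ O M)
  O-attained M = proj₁ (proj₂ (optimalCount M))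

  O-minimal : ∀ M y → value y ≡ M → O M ≤ sumFin y
  O-minimal M = proj₂ (proj₂ (optimalCount M))

  O-+b : ∀ M i → O (M + b i) ≤ suc (O M)
  O-+b M i with O-attained M
  ... | x , x↦M , Σx≡OM = subst (O (M + b i) ≤_) (trans (sumFin-addCoin x i) (cong suc Σx≡OM))
                             (O-minimal (M + b i) (addCoin x i) (trans (value-addCoin x i) (cong (_+ b i) x↦M)))

  O-∸b : ∀ N y i → value y ≡ N → 0 < y i → suc (O (N ∸ b i)) ≤ sumFin y
  O-∸b N y i y↦N 0<yi = subst (suc (O (N ∸ b i)) ≤_) (sumFin-removeCoin y i 0<yi)
    (s≤s (O-minimal (N ∸ b i) (removeCoin y i) (value-removeCoin-≡∸ y i N y↦N 0<yi)))

module LastArgmax (f : ℕ → ℕ) where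

  lastArgmax : ℕ → ℕ
  lastArgmax zero    = 0
  lastArgmax (suc n) with f (lastArgmax n) ≤? f n
  ... | yes _ = n
  ... | no  _ = lastArgmax n

  IsLastArgmax : ℕ → ℕ → Set
  IsLastArgmax n x = x < n × (∀ y → y < n → f y ≤ f x) × (∀ y → x < y → y < n → f y < f x)

  IsLastArgmax-extend-new : ∀ {n} → (∀ y → y < n → f y ≤ f n) → IsLastArgmax (suc n) n
  IsLastArgmax-extend-new {n} max = ≤-refl , below , λ y n<y y≤n → ⊥-elim (<⇒≱ n<y (m<1+n⇒m≤n y≤n))
    where
      below : ∀ y → y < suc n → f y ≤ f n
      below y y<1+n with m<1+n⇒m<n∨m≡n y<1+n
      ... | inj₁ y<n  = max y y<n
      ... | inj₂ refl = ≤-refl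

  IsLastArgmax-extend-old : ∀ {n x} → IsLastArgmax n x → f n < f x → IsLastArgmax (suc n) x
  IsLastArgmax-extend-old {n} (x<n , max , strict) fn<fx = m<n⇒m<1+n x<n , below , above
    where
      below : ∀ y → y < suc n → f y ≤ _
      below y y<1+n with m<1+n⇒m<n∨m≡n y<1+n
      ... | inj₁ y<n  = max y y<n
      ... | inj₂ refl = <⇒≤ fn<fx
      above : ∀ y → _ < y → y < suc n → f y < _
      above y x<y y<1+n with m<1+n⇒m<n∨m≡n y<1+n
      ... | inj₁ y<n  = strict y x<y y<n
      ... | inj₂ refl = fn<fx

  lastArgmax-spec : ∀ n → IsLastArgmax (suc n) (lastArgmax (suc n))
  lastArgmax-spec n with f (lastArgmax n) ≤? f n
  lastArgmax-spec zero    | yes _       = IsLastArgmax-extend-new (λ y ())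
  lastArgmax-spec zero    | no  f0≰f0   = ⊥-elim (f0≰f0 ≤-refl)
  lastArgmax-spec (suc n) | yes fx≤fn   =
    IsLastArgmax-extend-new (λ y y<1+n → ≤-trans (proj₁ (proj₂ (lastArgmax-spec n)) y y<1+n) fx≤fn)
  lastArgmax-spec (suc n) | no  fx≰fn   = IsLastArgmax-extend-old (lastArgmax-spec n) (≰⇒> fx≰fn)

  IsLastArgmax-unique : ∀ {n x x′} → IsLastArgmax n x → IsLastArgmax n x′ → x ≡ x′
  IsLastArgmax-unique {x = x} {x′} (x<n , max , strict) (x′<n , max′ , strict′) with <-cmp x x′
  ... | tri≈ _ x≡x′ _ = x≡x′
  ... | tri< x<x′ _ _ = ⊥-elim (<⇒≱ (strict x′ x<x′ x′<n) (max′ x x<n))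
  ... | tri> _ _ x′<x = ⊥-elim (<⇒≱ (strict′ x x′<x x<n) (max x′ x′<n))

  IsLastArgmax-mono : ∀ {n n′ x x′} → n ≤ n′ → IsLastArgmax n x → IsLastArgmax n′ x′ → x ≤ x′ × f x ≤ f x′
  IsLastArgmax-mono {x = x} {x′} n≤n′ (x<n , max , _) (_ , max′ , strict′) = x≤x′ , max′ x (≤-trans x<n n≤n′)
    where
      x≤x′ : x ≤ x′
      x≤x′ with x ≤? x′
      ... | yes x≤x′ = x≤x′
      ... | no  x≰x′ = ⊥-elim (<⇒≱ (strict′ x (≰⇒> x≰x′) (≤-trans x<n n≤n′))
                                   (max x′ (<-trans (≰⇒> x≰x′) x<n)))

  IsLastArgmax-+ : ∀ {n x} p → (∀ y → f (y + p) ≤ suc (f y)) → (∀ y → y < p → f y ≤ suc (f x)) →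
                   f (x + p) ≡ suc (f x) → IsLastArgmax n x → IsLastArgmax (n + p) (x + p)
  IsLastArgmax-+ {n} {x} p f+p≤ small f[x+p] (x<n , max , strict) = +-monoˡ-< p x<n , below , above
    where
      f≤f[∸p] : ∀ y → p ≤ y → f y ≤ suc (f (y ∸ p))
      f≤f[∸p] y p≤y = subst (λ z → f z ≤ suc (f (y ∸ p))) (m∸n+n≡m p≤y) (f+p≤ (y ∸ p))
      ∸p< : ∀ {y m} → p ≤ y → y < m + p → y ∸ p < m
      ∸p< {y} {m} p≤y y<m+p = subst (y ∸ p <_) (m+n∸n≡m m p) (∸-monoˡ-< y<m+p p≤y)
      below : ∀ y → y < n + p → f y ≤ f (x + p)
      below y y<n+p with y <? p
      ... | yes y<p = subst (f y ≤_) (sym f[x+p]) (small y y<p)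
      ... | no  y≮p = subst (f y ≤_) (sym f[x+p])
                        (≤-trans (f≤f[∸p] y (≮⇒≥ y≮p)) (s≤s (max (y ∸ p) (∸p< (≮⇒≥ y≮p) y<n+p))))
      above : ∀ y → x + p < y → y < n + p → f y < f (x + p)
      above y x+p<y y<n+p = subst (f y <_) (sym f[x+p])
        (s≤s (≤-trans (f≤f[∸p] y p≤y) (strict (y ∸ p) x<y∸p (∸p< p≤y y<n+p))))
        where
          p≤y = ≤-trans (m≤n+m p x) (<⇒≤ x+p<y)
          x<y∸p = subst (_< y ∸ p) (m+n∸n≡m x p) (∸-monoˡ-< x+p<y (m≤n+m p x))

quasiPeriodic-iterate : ∀ (g : ℕ → ℕ) N p q → (∀ a → N ≤ a → g (a + p) ≡ g a + q) →
                        ∀ a t → N ≤ a → g (a + t * p) ≡ g a + t * q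
quasiPeriodic-iterate g N p q step a zero    N≤a =
  trans (cong g (+-identityʳ a)) (sym (+-identityʳ (g a)))
quasiPeriodic-iterate g N p q step a (suc t) N≤a = begin
  g (a + (p + t * p))   ≡⟨ cong g (solve (a ∷ p ∷ t ∷ [])) ⟩
  g (a + t * p + p)     ≡⟨ step (a + t * p) (≤-trans N≤a (m≤m+n a (t * p))) ⟩
  g (a + t * p) + q     ≡⟨ cong (_+ q) (quasiPeriodic-iterate g N p q step a t N≤a) ⟩
  g a + t * q + q       ≡⟨ trans (+-assoc (g a) (t * q) q) (cong (g a +_) (+-comm (t * q) q)) ⟩
  g a + (q + t * q)     ∎
  where open ≡-Reasoning

ceilDiv≤⇒≤* : ∀ x n u → 0 < n → ceilDiv x n ≤ u → x ≤ u * n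
ceilDiv≤⇒≤* x (suc y) u _ ⌈x/n⌉≤u = +-cancelʳ-≤ y x (u * suc y) (begin
  x + y                                       ≡⟨ m≡m%n+[m/n]*n (x + y) (suc y) ⟩
  (x + y) % suc y + (x + y) / suc y * suc y
    ≤⟨ +-mono-≤ (m<1+n⇒m≤n (m%n<n (x + y) (suc y))) (*-monoˡ-≤ (suc y) ⌈x/n⌉≤u) ⟩
  y + u * suc y                               ≡⟨ +-comm y _ ⟩
  u * suc y + y                               ∎)
  where open ≤-Reasoning

modN+floorDiv* : ∀ x n → 0 < n → x ≡ modN x n + floorDiv x n * n
modN+floorDiv* x (suc n) _ = m≡m%n+[m/n]*n x (suc n)

modN< : ∀ x n → 0 < n → modN x n < n
modN< x (suc n) _ = m%n<n x (suc n)

-- Multiplying the two bounds on o gives D·M + D·B ≤ c₁·p·B ≤ u·D·B ≤ D·M, where B = p + D.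
count-bounds-incompatible : ∀ M u c₁ p D o → 0 < D → c₁ * p ≤ u * D → u * (p + D) ≤ M →
                            (p + D) * o ≤ M + suc c₁ * (p + D) → M + (p + D) ≤ p * o → ⊥
count-bounds-incompatible M u c₁ p D o 0<D c₁p≤uD uB≤M Bo≤ M+B≤po =
  <⇒≱ (*-mono-≤ 0<D (≤-trans 0<D (m≤n+m D p))) (≤-reflexive DB≡0)
  where
    open ≤-Reasoning
    multiplied : (p * M + p * (p + D)) + (D * M + D * (p + D)) ≤ (p * M + p * (p + D)) + c₁ * p * (p + D)
    multiplied = begin
      (p * M + p * (p + D)) + (D * M + D * (p + D)) ≡⟨ solve (M ∷ p ∷ D ∷ []) ⟩
      (p + D) * (M + (p + D))                       ≤⟨ *-monoʳ-≤ (p + D) M+B≤po ⟩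
      (p + D) * (p * o)                             ≡⟨ solve (p ∷ D ∷ o ∷ []) ⟩
      p * ((p + D) * o)                             ≤⟨ *-monoʳ-≤ p Bo≤ ⟩
      p * (M + suc c₁ * (p + D))                    ≡⟨ solve (M ∷ c₁ ∷ p ∷ D ∷ []) ⟩
      (p * M + p * (p + D)) + c₁ * p * (p + D)      ∎
    c₁pB≤DM : c₁ * p * (p + D) ≤ D * M
    c₁pB≤DM = begin
      c₁ * p * (p + D)  ≤⟨ *-monoˡ-≤ (p + D) c₁p≤uD ⟩
      u * D * (p + D)   ≡⟨ solve (u ∷ D ∷ p ∷ []) ⟩
      D * (u * (p + D)) ≤⟨ *-monoʳ-≤ D uB≤M ⟩
      D * M             ∎
    DB≡0 : D * (p + D) ≡ 0
    DB≡0 = n≤0⇒n≡0 (+-cancelˡ-≤ (D * M) _ _ (begin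
      D * M + D * (p + D) ≤⟨ +-cancelˡ-≤ (p * M + p * (p + D)) _ _ multiplied ⟩
      c₁ * p * (p + D)    ≤⟨ c₁pB≤DM ⟩
      D * M               ≡⟨ +-identityʳ (D * M) ⟨
      D * M + 0           ∎))

residue-offset : ∀ n a r s t → n + a * s ≡ r + a * t → r < n + a → ∃ λ K → n ≡ r + a * K
residue-offset n a r s t eq r<n+a with s ≤? t
... | yes s≤t with m≤n⇒∃[o]m+o≡n s≤t
...   | K , refl = K , +-cancelʳ-≡ (a * s) n (r + a * K) (trans eq (solve (r ∷ a ∷ s ∷ K ∷ [])))
residue-offset n a r s t eq r<n+a | no s≰t with m≤n⇒∃[o]m+o≡n (≰⇒> s≰t)
... | k , refl = ⊥-elim (<⇒≱ r<n+a (begin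
  n + a                   ≤⟨ +-monoʳ-≤ n (m≤m*n a (suc k)) ⟩
  n + a * suc k           ≡⟨ +-cancelʳ-≡ (a * t) _ r (trans regroup eq) ⟩
  r                       ∎))
  where
    open ≤-Reasoning
    regroup : n + a * suc k + a * t ≡ n + a * (suc t + k)
    regroup = solve (n ∷ a ∷ k ∷ t ∷ [])

mod-inverse : ∀ a′ d → Coprime (suc a′) d → ∃ λ e → ∃ λ s → ∃ λ t → 1 + suc a′ * s ≡ d * e + suc a′ * t
mod-inverse a′ d coprime with coprime-Bézout coprime
... | Bézout.Identity.-+ x y eq = y , x , 0 , (begin
  1 + suc a′ * x   ≡⟨ cong suc (*-comm (suc a′) x) ⟩
  1 + x * suc a′   ≡⟨ eq ⟩
  y * d            ≡⟨ solve (a′ ∷ y ∷ d ∷ []) ⟩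
  d * y + suc a′ * 0 ∎)
  where open ≡-Reasoning
... | Bézout.Identity.+- x y eq = y * a′ , x * a′ , 1 , (begin
  1 + suc a′ * (x * a′)   ≡⟨ solve (a′ ∷ x ∷ []) ⟩
  1 + x * suc a′ * a′     ≡⟨ cong (λ z → 1 + z * a′) (sym eq) ⟩
  1 + (1 + y * d) * a′    ≡⟨ solve (a′ ∷ y ∷ d ∷ []) ⟩
  d * (y * a′) + suc a′ * 1 ∎)
  where open ≡-Reasoning

-- n ≡ d·x (mod a), written without subtraction.
d*-hits-residue : ∀ a d → Coprime a d → 0 < a → ∀ n →
                  ∃ λ x → x < a × ∃ λ s → ∃ λ t → n + a * s ≡ d * x + a * t
d*-hits-residue (suc a′) d coprime _ n with mod-inverse a′ d coprime
... | e , s , t , 1+as≡de+at = x , m%n<n (e * n) a , s * n , d * q + t * n , (begin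
  n + a * (s * n)               ≡⟨ factor n a s ⟩
  (1 + a * s) * n               ≡⟨ cong (_* n) 1+as≡de+at ⟩
  (d * e + a * t) * n           ≡⟨ expand d e a t n ⟩
  d * (e * n) + a * (t * n)     ≡⟨ cong (λ z → d * z + a * (t * n)) (m≡m%n+[m/n]*n (e * n) a) ⟩
  d * (x + q * a) + a * (t * n) ≡⟨ regroup d x q a (t * n) ⟩
  d * x + a * (d * q + t * n)   ∎)
  where
    open ≡-Reasoning
    a = suc a′
    x = e * n % a
    q = e * n / a
    factor : ∀ n a s → n + a * (s * n) ≡ (1 + a * s) * n
    factor = solve-∀
    expand : ∀ d e a t n → (d * e + a * t) * n ≡ d * (e * n) + a * (t * n)
    expand = solve-∀
    regroup : ∀ d x q a u → d * (x + q * a) + a * u ≡ d * x + a * (d * q + u)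
    regroup = solve-∀

coprime-cancel-≤ : ∀ {a d x y X Y} → Coprime a d → d * x + a * X ≡ d * y + a * Y → x ≤ y → y < x + a → x ≡ y
coprime-cancel-≤ {a} {d} {x} {y} {X} {Y} coprime eq x≤y y<x+a with m≤n⇒∃[o]m+o≡n x≤y
... | zero  , refl = sym (+-identityʳ x)
... | suc e , refl = ⊥-elim (<⇒≱ (+-cancelˡ-< x (suc e) a y<x+a) (∣⇒≤ a∣1+e))
  where
    aX≡aY+d[1+e] : a * X ≡ a * Y + d * suc e
    aX≡aY+d[1+e] = +-cancelˡ-≡ (d * x) _ _ (trans eq (solve (d ∷ x ∷ e ∷ a ∷ Y ∷ [])))
    a∣1+e : a ∣ suc e
    a∣1+e = coprime-divisor coprime (∣m+n∣m⇒∣n (subst (a ∣_) aX≡aY+d[1+e] (m∣m*n X)) (m∣m*n Y))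

coprime-cancel : ∀ {a d x y X Y} → Coprime a d → d * x + a * X ≡ d * y + a * Y → x < y + a → y < x + a → x ≡ y
coprime-cancel {x = x} {y} coprime eq x<y+a y<x+a with ≤-total x y
... | inj₁ x≤y = coprime-cancel-≤ coprime eq x≤y y<x+a
... | inj₂ y≤x = sym (coprime-cancel-≤ coprime (sym eq) y≤x x<y+a)

import Data.Integer as ℤ
import Data.Integer.Properties as ℤP
import Data.Integer.Tactic.RingSolver as ℤ-Solver

module _ where
  open ℤ using (+_)

  IsFrobenius-∸ : ∀ {k} (A : Fin k → ℕ) G a → a ≤ G →
                  (∀ x → sumFin (λ i → x i * A i) + a ≢ G) →
                  (∀ m → G < m + a → Representable A (+ m)) →
                  IsFrobenius A (+ G ℤ.- + a)
  IsFrobenius-∸ A G a a≤G not-rep rep = not-rep′ , rep′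
    where
      G-a≡G∸a : + G ℤ.- + a ≡ + (G ∸ a)
      G-a≡G∸a = trans (ℤP.m-n≡m⊖n G a) (ℤP.⊖-≥ a≤G)
      not-rep′ : ¬ Representable A (+ G ℤ.- + a)
      not-rep′ (x , eq) = not-rep x
        (trans (cong (_+ a) (ℤP.+-injective (trans (sym eq) G-a≡G∸a))) (m∸n+n≡m a≤G))
      rep′ : ∀ z → + G ℤ.- + a ℤ.< z → Representable A z
      rep′ z G-a<z with subst (ℤ._< z) G-a≡G∸a G-a<z
      ... | ℤ.+<+ G∸a<m = rep _ (subst (_< _ + a) (m∸n+n≡m a≤G) (+-monoˡ-< a G∸a<m))

  cast-closed-form : ∀ w h a r d B L t →
    (+ (w * h) ℤ.- + 1) ℤ.* + a ℤ.+ + (r * d) ℤ.+ + (h * a + B * d) ℤ.* (+ (L + t) ℤ.- + L)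
    ≡ + (h * a * (w + t) + d * (r + t * B)) ℤ.- + a
  cast-closed-form w h a r d B L t = begin
    (+ (w * h) ℤ.- + 1) ℤ.* + a ℤ.+ + (r * d) ℤ.+ + (h * a + B * d) ℤ.* (+ (L + t) ℤ.- + L)
      ≡⟨ cong₂ (λ p q → (p ℤ.- + 1) ℤ.* + a ℤ.+ q ℤ.+ + (h * a + B * d) ℤ.* (+ (L + t) ℤ.- + L))
               (ℤP.pos-* w h) (ℤP.pos-* r d) ⟩
    (+ w ℤ.* + h ℤ.- + 1) ℤ.* + a ℤ.+ + r ℤ.* + d ℤ.+ + (h * a + B * d) ℤ.* (+ (L + t) ℤ.- + L)
      ≡⟨ cong₂ (λ p q → (+ w ℤ.* + h ℤ.- + 1) ℤ.* + a ℤ.+ + r ℤ.* + d ℤ.+ p ℤ.* (q ℤ.- + L))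
               (trans (ℤP.pos-+ (h * a) (B * d)) (cong₂ ℤ._+_ (ℤP.pos-* h a) (ℤP.pos-* B d))) (ℤP.pos-+ L t) ⟩
    (+ w ℤ.* + h ℤ.- + 1) ℤ.* + a ℤ.+ + r ℤ.* + d ℤ.+ (+ h ℤ.* + a ℤ.+ + B ℤ.* + d) ℤ.* ((+ L ℤ.+ + t) ℤ.- + L)
      ≡⟨ closed-form (+ w) (+ h) (+ a) (+ r) (+ d) (+ B) (+ L) (+ t) ⟩
    (+ h ℤ.* + a ℤ.* (+ w ℤ.+ + t) ℤ.+ + d ℤ.* (+ r ℤ.+ + t ℤ.* + B)) ℤ.- + a
      ≡⟨ cong (ℤ._- + a) cast-V ⟨
    + (h * a * (w + t) + d * (r + t * B)) ℤ.- + a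
      ∎
    where
      open ≡-Reasoning
      closed-form : ∀ w h a r d B L t →
        (w ℤ.* h ℤ.- ℤ.1ℤ) ℤ.* a ℤ.+ r ℤ.* d ℤ.+ (h ℤ.* a ℤ.+ B ℤ.* d) ℤ.* ((L ℤ.+ t) ℤ.- L)
        ≡ (h ℤ.* a ℤ.* (w ℤ.+ t) ℤ.+ d ℤ.* (r ℤ.+ t ℤ.* B)) ℤ.- a
      closed-form = ℤ-Solver.solve-∀
      cast-V : + (h * a * (w + t) + d * (r + t * B)) ≡ + h ℤ.* + a ℤ.* (+ w ℤ.+ + t) ℤ.+ + d ℤ.* (+ r ℤ.+ + t ℤ.* + B)
      cast-V = begin
        + (h * a * (w + t) + d * (r + t * B))           ≡⟨ ℤP.pos-+ (h * a * (w + t)) (d * (r + t * B)) ⟩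
        + (h * a * (w + t)) ℤ.+ + (d * (r + t * B))
          ≡⟨ cong₂ ℤ._+_ (ℤP.pos-* (h * a) (w + t)) (ℤP.pos-* d (r + t * B)) ⟩
        + (h * a) ℤ.* + (w + t) ℤ.+ + d ℤ.* + (r + t * B)
          ≡⟨ cong₂ (λ p q → p ℤ.* + (w + t) ℤ.+ + d ℤ.* q) (ℤP.pos-* h a)
                   (trans (ℤP.pos-+ r (t * B)) (cong (ℤ._+_ (+ r)) (ℤP.pos-* t B))) ⟩
        + h ℤ.* + a ℤ.* + (w + t) ℤ.+ + d ℤ.* (+ r ℤ.+ + t ℤ.* + B)
          ≡⟨ cong (λ p → + h ℤ.* + a ℤ.* p ℤ.+ + d ℤ.* (+ r ℤ.+ + t ℤ.* + B)) (ℤP.pos-+ w t) ⟩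
        + h ℤ.* + a ℤ.* (+ w ℤ.+ + t) ℤ.+ + d ℤ.* (+ r ℤ.+ + t ℤ.* + B) ∎

module FrobeniusOfA {n} (b : Fin (suc n) → ℕ) (b₀≡1 : b zero ≡ 1) (b-pos : ∀ i → 0 < b i)
                    (h d a : ℕ) where

  open CoinProblem b b₀≡1 b-pos

  V : ℕ → ℕ
  V y = h * a * O y + d * y

  sumFin-Aseq : ∀ (x : Fin (suc (suc n)) → ℕ) → let y = λ i → x (suc i) in
                sumFin (λ i → x i * Aseq b h d a i) ≡ x zero * a + (h * a * sumFin y + d * value y)
  sumFin-Aseq x = cong (_+_ (x zero * a)) (begin
    sumFin (λ i → x (suc i) * (h * a + d * b i))
      ≡⟨ sumFin-cong (λ i → distribute (x (suc i)) h a d (b i)) ⟩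
    sumFin (λ i → h * a * x (suc i) + d * (b i * x (suc i)))
      ≡⟨ sumFin-+ (λ i → h * a * x (suc i)) (λ i → d * (b i * x (suc i))) ⟩
    sumFin (λ i → h * a * x (suc i)) + sumFin (λ i → d * (b i * x (suc i)))
      ≡⟨ cong₂ _+_ (sumFin-*ˡ (h * a) (λ i → x (suc i))) (sumFin-*ˡ d (λ i → b i * x (suc i))) ⟩
    h * a * sumFin (λ i → x (suc i)) + d * value (λ i → x (suc i))
      ∎)
    where
      open ≡-Reasoning
      distribute : ∀ y h a d b → y * (h * a + d * b) ≡ h * a * y + d * (b * y)
      distribute = solve-∀

  module _ (coprime : Coprime a d) (B : ℕ) (b≤B : ∀ i → b i ≤ B) (x : ℕ) (x<a : x < a) (B·Ox≤x+a : B * O x ≤ x + a) where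

    dominates : ∀ x₀ y → x₀ * a + (h * a * sumFin y + d * value y) + a ≡ V x → x ≤ value y × O x ≤ sumFin y
    dominates x₀ y eq with x + a ≤? value y
    ... | yes x+a≤W = ≤-trans (m≤m+n x a) x+a≤W
                    , *-cancelˡ-≤ B {{>-nonZero (≤-trans (b-pos zero) (b≤B zero))}}
                        (≤-trans B·Ox≤x+a (≤-trans x+a≤W (value-≤ B y (λ i → *-monoˡ-≤ (y i) (b≤B i)))))
    ... | no  x+a≰W = ≤-reflexive x≡W , O-minimal x y (sym x≡W)
      where
        lhs-form : ∀ x₀ a h S d W → x₀ * a + (h * a * S + d * W) + a ≡ d * W + a * (x₀ + h * S + 1)
        lhs-form = solve-∀
        rhs-form : ∀ h a o d x → h * a * o + d * x ≡ d * x + a * (h * o)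
        rhs-form = solve-∀
        x≡W : x ≡ value y
        x≡W = coprime-cancel coprime
          (trans (sym (rhs-form h a (O x) d x)) (trans (sym eq) (lhs-form x₀ a h (sumFin y) d (value y))))
          (≤-trans x<a (m≤n+m a (value y))) (≰⇒> x+a≰W)

    not-representable : ∀ x₀ y → x₀ * a + (h * a * sumFin y + d * value y) + a ≢ V x
    not-representable x₀ y eq = <⇒≱ (≤-<-trans V≤ (m<m+n _ (≤-trans (s≤s z≤n) x<a))) (≤-reflexive eq)
      where
        x≤W,Ox≤S = dominates x₀ y eq
        V≤ : V x ≤ x₀ * a + (h * a * sumFin y + d * value y)
        V≤ = ≤-trans (+-mono-≤ (*-monoʳ-≤ (h * a) (proj₂ x≤W,Ox≤S)) (*-monoʳ-≤ d (proj₁ x≤W,Ox≤S)))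
                     (m≤n+m _ (x₀ * a))

  module _ (coprime : Coprime a d) (x : ℕ) (x<a : x < a) (V≤Vx : ∀ y → y < a → V y ≤ V x) where

    representable-above : ∀ m → V x < m + a → Representable (Aseq b h d a) (ℤ.+ m)
    representable-above m Vx<m+a with d*-hits-residue a d coprime (≤-trans (s≤s z≤n) x<a) m
    ... | r , r<a , s , t , m≡dr[a] with residue-offset m a (d * r) s t m≡dr[a] dr<m+a
      where dr<m+a = ≤-<-trans (≤-trans (m≤n+m (d * r) _) (V≤Vx r r<a)) Vx<m+a
    ... | K , m≡dr+aK = z , cong ℤ.+_ (sym (trans (sumFin-Aseq z) z-sum))
      where
        y = proj₁ (O-attained r)
        y↦r = proj₁ (proj₂ (O-attained r))
        Σy≡Or = proj₂ (proj₂ (O-attained r))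
        hOr≤K : h * O r ≤ K
        hOr≤K = m<1+n⇒m≤n (*-cancelʳ-< a (h * O r) (suc K) (+-cancelʳ-< (d * r) _ _ (begin-strict
          h * O r * a + d * r   ≡⟨ swap h (O r) a d r ⟩
          V r                   ≤⟨ V≤Vx r r<a ⟩
          V x                   <⟨ Vx<m+a ⟩
          m + a                 ≡⟨ cong (_+ a) m≡dr+aK ⟩
          d * r + a * K + a     ≡⟨ solve (d ∷ r ∷ a ∷ K ∷ []) ⟩
          suc K * a + d * r     ∎)))
          where
            open ≤-Reasoning
            swap : ∀ h o a d r → h * o * a + d * r ≡ h * a * o + d * r
            swap = solve-∀
        z : Fin (suc (suc n)) → ℕ
        z zero    = K ∸ h * O r
        z (suc i) = y i
        z-sum : (K ∸ h * O r) * a + (h * a * sumFin y + d * value y) ≡ m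
        z-sum = begin
          (K ∸ h * O r) * a + (h * a * sumFin y + d * value y)
            ≡⟨ cong₂ (λ S W → (K ∸ h * O r) * a + (h * a * S + d * W)) Σy≡Or y↦r ⟩
          (K ∸ h * O r) * a + (h * a * O r + d * r)           ≡⟨ regroup (K ∸ h * O r) a h (O r) d r ⟩
          (K ∸ h * O r + h * O r) * a + d * r                 ≡⟨ cong (λ k → k * a + d * r) (m∸n+n≡m hOr≤K) ⟩
          K * a + d * r                                       ≡⟨ solve (K ∷ a ∷ d ∷ r ∷ []) ⟩
          d * r + a * K                                       ≡⟨ m≡dr+aK ⟨
          m                                                   ∎
          where
            open ≡-Reasoning
            regroup : ∀ k a h o d r → k * a + (h * a * o + d * r) ≡ (k + h * o) * a + d * r
            regroup = solve-∀

  frobenius : Coprime a d → ∀ B → (∀ i → b i ≤ B) → ∀ x → x < a → 0 < h → 0 < O x → B * O x ≤ x + a →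
              (∀ y → y < a → V y ≤ V x) → IsFrobenius (Aseq b h d a) (ℤ.+ V x ℤ.- ℤ.+ a)
  frobenius coprime B b≤B x x<a 0<h 0<Ox B·Ox≤x+a V≤Vx =
    IsFrobenius-∸ (Aseq b h d a) (V x) a a≤Vx
      (λ z eq → not-representable coprime B b≤B x x<a B·Ox≤x+a (z zero) (λ i → z (suc i))
                  (trans (cong (_+ a) (sym (sumFin-Aseq z))) eq))
      (representable-above coprime x x<a V≤Vx)
    where
      a≤Vx : a ≤ V x
      a≤Vx = ≤-trans (m≤n*m a h {{>-nonZero 0<h}})
               (≤-trans (m≤m*n (h * a) (O x) {{>-nonZero 0<Ox}}) (m≤m+n (h * a * O x) (d * x)))

module Setting (m : ℕ) (b : Fin (suc (suc m)) → ℕ) (b₀≡1 : b zero ≡ 1)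
               (b-strict : ∀ i j → i <ᶠ j → b i < b j)
               (c : ℕ) (c-max : IsMaxOB b (b (fromℕ (suc m))) c) (2≤c : 2 ≤ c) (u : ℕ)
               (u-ceil : ceilDiv ((c ∸ 1) * b (inject₁ (fromℕ m))) (b (fromℕ (suc m)) ∸ b (inject₁ (fromℕ m))) ≤ u)
               (0<u : 0 < u) where

  last penultimate : Fin (suc (suc m))
  last        = fromℕ (suc m)
  penultimate = inject₁ (fromℕ m)

  bₖ bₖ₋₁ : ℕ
  bₖ   = b last
  bₖ₋₁ = b penultimate

  b-mono : ∀ i j → toℕ i ≤ toℕ j → b i ≤ b j
  b-mono i j i≤j with m≤n⇒m<n∨m≡n i≤j
  ... | inj₁ i<j = <⇒≤ (b-strict i j i<j)
  ... | inj₂ i≡j = ≤-reflexive (cong b (toℕ-injective i≡j))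

  b-pos : ∀ i → 0 < b i
  b-pos i = subst (_≤ b i) b₀≡1 (b-mono zero i z≤n)

  b≤bₖ : ∀ i → b i ≤ bₖ
  b≤bₖ i = b-mono i last (subst (toℕ i ≤_) (sym (toℕ-fromℕ (suc m))) (toℕ≤pred[n] i))

  toℕ-penultimate : toℕ penultimate ≡ m
  toℕ-penultimate = trans (toℕ-inject₁ (fromℕ m)) (toℕ-fromℕ m)

  bₖ₋₁<bₖ : bₖ₋₁ < bₖ
  bₖ₋₁<bₖ = b-strict penultimate last (subst₂ _<_ (sym toℕ-penultimate) (sym (toℕ-fromℕ (suc m))) ≤-refl)

  b≤bₖ₋₁ : ∀ i → i ≢ last → b i ≤ bₖ₋₁
  b≤bₖ₋₁ i i≢last = b-mono i penultimate (subst (toℕ i ≤_) (sym toℕ-penultimate)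
    (m<1+n⇒m≤n (≤∧≢⇒< (toℕ≤pred[n] i) (λ eq → i≢last (toℕ-injective (trans eq (sym (toℕ-fromℕ (suc m)))))))))

  2≤bₖ : 2 ≤ bₖ
  2≤bₖ = subst (λ b₀ → suc b₀ ≤ bₖ) b₀≡1 (b-strict zero last (s≤s z≤n))

  0<bₖ : 0 < bₖ
  0<bₖ = b-pos last

  open CoinProblem b b₀≡1 b-pos

  O-lower : ∀ M → M ≤ bₖ * O M
  O-lower M with O-attained M
  ... | x , x↦M , Σx≡OM = subst₂ _≤_ x↦M (cong (bₖ *_) Σx≡OM) (value-≤ bₖ x (λ i → *-monoˡ-≤ (x i) (b≤bₖ i)))

  O-residue≤c : ∀ ρ → ρ < bₖ → O ρ ≤ c
  O-residue≤c ρ ρ<bₖ = proj₂ c-max ρ (O ρ) ρ<bₖ (proj₂ (optimalCount ρ))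

  O-+*bₖ : ∀ ρ q → O (ρ + q * bₖ) ≤ O ρ + q
  O-+*bₖ ρ zero    = ≤-reflexive (trans (cong O (+-identityʳ ρ)) (sym (+-identityʳ (O ρ))))
  O-+*bₖ ρ (suc q) = begin
    O (ρ + (bₖ + q * bₖ)) ≡⟨ cong O (trans (cong (ρ +_) (+-comm bₖ (q * bₖ))) (sym (+-assoc ρ (q * bₖ) bₖ))) ⟩
    O (ρ + q * bₖ + bₖ)   ≤⟨ O-+b (ρ + q * bₖ) last ⟩
    suc (O (ρ + q * bₖ))  ≤⟨ s≤s (O-+*bₖ ρ q) ⟩
    suc (O ρ + q)         ≡⟨ +-suc (O ρ) q ⟨
    O ρ + suc q           ∎
    where open ≤-Reasoning

  O-upper : ∀ M → bₖ * O M ≤ M + c * bₖ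
  O-upper M = begin
    bₖ * O M             ≡⟨ cong (λ N → bₖ * O N) M≡ρ+qbₖ ⟩
    bₖ * O (ρ + q * bₖ)  ≤⟨ *-monoʳ-≤ bₖ (O-+*bₖ ρ q) ⟩
    bₖ * (O ρ + q)       ≤⟨ *-monoʳ-≤ bₖ (+-monoˡ-≤ q (O-residue≤c ρ (modN< M bₖ 0<bₖ))) ⟩
    bₖ * (c + q)         ≡⟨ trans (*-comm bₖ (c + q)) (trans (*-distribʳ-+ bₖ c q) (+-comm (c * bₖ) (q * bₖ))) ⟩
    q * bₖ + c * bₖ      ≤⟨ +-monoˡ-≤ (c * bₖ) (m≤n+m (q * bₖ) ρ) ⟩
    ρ + q * bₖ + c * bₖ  ≡⟨ cong (_+ c * bₖ) M≡ρ+qbₖ ⟨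
    M + c * bₖ           ∎
    where
      open ≤-Reasoning
      ρ = modN M bₖ
      q = floorDiv M bₖ
      M≡ρ+qbₖ = modN+floorDiv* M bₖ 0<bₖ

  -- Beyond u·bₖ an optimal representation must use the largest coin: otherwise all its coins are
  -- at most bₖ₋₁, which together with O-upper contradicts the choice of u.
  O-+bₖ : ∀ M → u * bₖ ≤ M → O (M + bₖ) ≡ suc (O M)
  O-+bₖ M u·bₖ≤M = ≤-antisym (O-+b M last) 1+OM≤
    where
      D = bₖ ∸ bₖ₋₁
      bₖ₋₁+D≡bₖ : bₖ₋₁ + D ≡ bₖ
      bₖ₋₁+D≡bₖ = m+[n∸m]≡n (<⇒≤ bₖ₋₁<bₖ)
      1+[c∸1]≡c : suc (c ∸ 1) ≡ c
      1+[c∸1]≡c = trans (+-comm 1 (c ∸ 1)) (m∸n+n≡m (≤-trans (s≤s z≤n) 2≤c))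
      1+OM≤ : suc (O M) ≤ O (M + bₖ)
      1+OM≤ with O-attained (M + bₖ)
      ... | y , y↦M+bₖ , Σy≡O with y last in y-last
      ... | suc _ = subst₂ (λ N o → suc (O N) ≤ o) (m+n∸n≡m M bₖ) Σy≡O
                      (O-∸b (M + bₖ) y last y↦M+bₖ (subst (0 <_) (sym y-last) (s≤s z≤n)))
      ... | zero with suc (O M) ≤? O (M + bₖ)
      ...   | yes 1+OM≤ = 1+OM≤
      ...   | no  1+OM≰ = ⊥-elim (count-bounds-incompatible M u (c ∸ 1) bₖ₋₁ D (O M) (m<n⇒0<n∸m bₖ₋₁<bₖ)
                  (ceilDiv≤⇒≤* _ D u (m<n⇒0<n∸m bₖ₋₁<bₖ) u-ceil)
                  (subst (λ B → u * B ≤ M) (sym bₖ₋₁+D≡bₖ) u·bₖ≤M)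
                  (subst₂ (λ B c′ → B * O M ≤ M + c′ * B) (sym bₖ₋₁+D≡bₖ) (sym 1+[c∸1]≡c) (O-upper M))
                  (begin
                    M + (bₖ₋₁ + D)         ≡⟨ cong (M +_) bₖ₋₁+D≡bₖ ⟩
                    M + bₖ                 ≡⟨ y↦M+bₖ ⟨
                    value y                ≤⟨ value-≤ bₖ₋₁ y small-coins ⟩
                    bₖ₋₁ * sumFin y        ≡⟨ cong (bₖ₋₁ *_) Σy≡O ⟩
                    bₖ₋₁ * O (M + bₖ)      ≤⟨ *-monoʳ-≤ bₖ₋₁ (m<1+n⇒m≤n (≰⇒> 1+OM≰)) ⟩
                    bₖ₋₁ * O M             ∎))
        where
          open ≤-Reasoning
          small-coins : ∀ i → b i * y i ≤ bₖ₋₁ * y i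
          small-coins i with i ≟ᶠ last
          ... | yes refl rewrite y-last = ≤-reflexive (trans (*-zeroʳ bₖ) (sym (*-zeroʳ bₖ₋₁)))
          ... | no  i≢last = *-monoˡ-≤ (y i) (b≤bₖ₋₁ i i≢last)

  L : ℕ
  L = u + c ∸ 1

  1+L≡u+c : suc L ≡ u + c
  1+L≡u+c = trans (+-comm 1 L) (m∸n+n≡m (≤-trans (≤-trans (s≤s z≤n) 2≤c) (m≤n+m c u)))

  1+u≤L : suc u ≤ L
  1+u≤L = m<1+n⇒m≤n (subst (suc (suc u) ≤_) (sym 1+L≡u+c) (subst (_≤ u + c) (+-comm u 2) (+-monoʳ-≤ u 2≤c)))

  c≤L : c ≤ L
  c≤L = m<1+n⇒m≤n (subst (suc c ≤_) (sym 1+L≡u+c) (+-monoˡ-≤ c 0<u))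

  0<L : 0 < L
  0<L = ≤-trans (s≤s z≤n) 1+u≤L

  0<L·bₖ : 0 < L * bₖ
  0<L·bₖ = *-mono-≤ 0<L 0<bₖ

  open LastArgmax O

  lastArgmax-IsLastArgmax : ∀ a → 0 < a → IsLastArgmax a (lastArgmax a)
  lastArgmax-IsLastArgmax (suc a′) _ = lastArgmax-spec a′

  module _ {a x : ℕ} (L·bₖ≤a : L * bₖ ≤ a) (x-max : IsLastArgmax a x) where

    private
      0<a : 0 < a
      0<a = ≤-trans 0<L·bₖ L·bₖ≤a
      instance a≢0 : NonZero a
      a≢0 = >-nonZero 0<a
      O≤Ox = proj₁ (proj₂ x-max)
      O<Ox = proj₂ (proj₂ x-max)

    L≤O[a-1] : L ≤ O (pred a)
    L≤O[a-1] with L ≤? O (pred a)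
    ... | yes L≤O = L≤O
    ... | no  L≰O = ⊥-elim (<⇒≱ 2≤bₖ (+-cancelʳ-≤ (bₖ * O (pred a)) bₖ 1 (begin
      bₖ + bₖ * O (pred a)     ≡⟨ *-suc bₖ (O (pred a)) ⟨
      bₖ * suc (O (pred a))    ≤⟨ *-monoʳ-≤ bₖ (≰⇒> L≰O) ⟩
      bₖ * L                   ≡⟨ *-comm bₖ L ⟩
      L * bₖ                   ≤⟨ L·bₖ≤a ⟩
      a                        ≡⟨ suc-pred a ⟨
      suc (pred a)             ≤⟨ s≤s (O-lower (pred a)) ⟩
      1 + bₖ * O (pred a)      ∎)))
      where open ≤-Reasoning

    L≤Ox : L ≤ O x
    L≤Ox = ≤-trans L≤O[a-1] (O≤Ox (pred a) (subst (pred a <_) (suc-pred a) ≤-refl))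

    -- x is within bₖ of the end: a later shift by bₖ would raise O past O x once x ≥ u·bₖ,
    -- while below u·bₖ the bound O-upper keeps O x ≤ L ≤ O (pred a).
    a≤x+bₖ : a ≤ x + bₖ
    a≤x+bₖ with a ≤? x + bₖ
    ... | yes a≤x+bₖ = a≤x+bₖ
    ... | no  a≰x+bₖ with u * bₖ ≤? x
    ...   | yes u·bₖ≤x =
      ⊥-elim (<⇒≱ (subst (O x <_) (sym (O-+bₖ x u·bₖ≤x)) ≤-refl) (O≤Ox (x + bₖ) (≰⇒> a≰x+bₖ)))
    ...   | no  u·bₖ≰x = ⊥-elim (<⇒≱ (O<Ox (pred a) x<pred[a] pred[a]<a) (≤-trans Ox≤L L≤O[a-1]))
      where
        open ≤-Reasoning
        pred[a]<a = subst (pred a <_) (suc-pred a) ≤-refl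
        x<pred[a] : x < pred a
        x<pred[a] = ≤-pred (subst (2 + x ≤_) (sym (suc-pred a))
                      (≤-trans (≤-trans (≤-reflexive (+-comm 2 x)) (+-monoʳ-≤ x 2≤bₖ)) (<⇒≤ (≰⇒> a≰x+bₖ))))
        Ox≤L : O x ≤ L
        Ox≤L = m<1+n⇒m≤n (subst (O x <_) (sym 1+L≡u+c) (*-cancelʳ-< bₖ (O x) (u + c) (begin-strict
          O x * bₖ          ≡⟨ *-comm (O x) bₖ ⟩
          bₖ * O x          ≤⟨ O-upper x ⟩
          x + c * bₖ        <⟨ +-monoˡ-< (c * bₖ) (≰⇒> u·bₖ≰x) ⟩
          u * bₖ + c * bₖ   ≡⟨ *-distribʳ-+ bₖ u c ⟨
          (u + c) * bₖ      ∎)))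

    u·bₖ≤x : u * bₖ ≤ x
    u·bₖ≤x = +-cancelʳ-≤ bₖ (u * bₖ) x (begin
      u * bₖ + bₖ   ≡⟨ +-comm (u * bₖ) bₖ ⟩
      suc u * bₖ    ≤⟨ *-monoˡ-≤ bₖ 1+u≤L ⟩
      L * bₖ        ≤⟨ L·bₖ≤a ⟩
      a             ≤⟨ a≤x+bₖ ⟩
      x + bₖ        ∎)
      where open ≤-Reasoning

    IsLastArgmax-+bₖ : IsLastArgmax (a + bₖ) (x + bₖ)
    IsLastArgmax-+bₖ = IsLastArgmax-+ bₖ (λ y → O-+b y last)
      (λ y y<bₖ → ≤-trans (O-residue≤c y y<bₖ) (≤-trans c≤L (≤-trans L≤Ox (n≤1+n (O x)))))
      (O-+bₖ x u·bₖ≤x) x-max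

    bₖ·Ox≤x+a : bₖ * O x ≤ x + a
    bₖ·Ox≤x+a = ≤-trans (O-upper x) (+-monoʳ-≤ x (≤-trans (*-monoˡ-≤ bₖ c≤L) L·bₖ≤a))

    -- For x < y < a, O y < O x costs at least h·a ≥ d·bₖ, while d·y exceeds d·x by less than d·bₖ.
    V≤Vx : ∀ h d → d * bₖ ≤ h * a → let open FrobeniusOfA b b₀≡1 b-pos h d a using (V) in
           ∀ y → y < a → V y ≤ V x
    V≤Vx h d d·bₖ≤h·a y y<a with y ≤? x
    ... | yes y≤x = +-mono-≤ (*-monoʳ-≤ (h * a) (O≤Ox y y<a)) (*-monoʳ-≤ d y≤x)
    ... | no  y≰x = begin
      h * a * O y + d * y              ≤⟨ +-monoʳ-≤ (h * a * O y) (*-monoʳ-≤ d (≤-trans (<⇒≤ y<a) a≤x+bₖ)) ⟩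
      h * a * O y + d * (x + bₖ)       ≡⟨ cong (h * a * O y +_) (*-distribˡ-+ d x bₖ) ⟩
      h * a * O y + (d * x + d * bₖ)   ≤⟨ +-monoʳ-≤ (h * a * O y) (+-monoʳ-≤ (d * x) d·bₖ≤h·a) ⟩
      h * a * O y + (d * x + h * a)    ≡⟨ regroup (h * a) (O y) (d * x) ⟩
      h * a * suc (O y) + d * x        ≤⟨ +-monoˡ-≤ (d * x) (*-monoʳ-≤ (h * a) (O<Ox y (≰⇒> y≰x) y<a)) ⟩
      h * a * O x + d * x              ∎
      where
        open ≤-Reasoning
        regroup : ∀ p o q → p * o + (q + p) ≡ p * suc o + q
        regroup = solve-∀

  lastArgmax-+bₖ : ∀ a → L * bₖ ≤ a → lastArgmax (a + bₖ) ≡ lastArgmax a + bₖ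
  lastArgmax-+bₖ a L·bₖ≤a = IsLastArgmax-unique
    (lastArgmax-IsLastArgmax (a + bₖ) (≤-trans 0<a (m≤m+n a bₖ)))
    (IsLastArgmax-+bₖ L·bₖ≤a (lastArgmax-IsLastArgmax a 0<a))
    where 0<a = ≤-trans 0<L·bₖ L·bₖ≤a

  O-lastArgmax-+bₖ : ∀ a → L * bₖ ≤ a → O (lastArgmax (a + bₖ)) ≡ O (lastArgmax a) + 1
  O-lastArgmax-+bₖ a L·bₖ≤a = begin
    O (lastArgmax (a + bₖ))   ≡⟨ cong O (lastArgmax-+bₖ a L·bₖ≤a) ⟩
    O (lastArgmax a + bₖ)     ≡⟨ O-+bₖ (lastArgmax a) (u·bₖ≤x L·bₖ≤a (lastArgmax-IsLastArgmax a 0<a)) ⟩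
    suc (O (lastArgmax a))    ≡⟨ +-comm 1 _ ⟩
    O (lastArgmax a) + 1      ∎
    where
      open ≡-Reasoning
      0<a = ≤-trans 0<L·bₖ L·bₖ≤a

  r w : ℕ → ℕ
  r j = lastArgmax (L * bₖ + j)
  w j = O (r j)

  lastArgmax-periodic : ∀ j t → lastArgmax (L * bₖ + j + t * bₖ) ≡ r j + t * bₖ
  lastArgmax-periodic j t = quasiPeriodic-iterate lastArgmax (L * bₖ) bₖ bₖ lastArgmax-+bₖ (L * bₖ + j) t (m≤m+n _ j)

  O-lastArgmax-periodic : ∀ j t → O (lastArgmax (L * bₖ + j + t * bₖ)) ≡ w j + t
  O-lastArgmax-periodic j t =
    trans (quasiPeriodic-iterate (λ a → O (lastArgmax a)) (L * bₖ) bₖ 1 O-lastArgmax-+bₖ (L * bₖ + j) t (m≤m+n _ j))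
          (cong (w j +_) (*-identityʳ t))

  r-w-mono : ∀ {i j} → i ≤ j → r i ≤ r j × w i ≤ w j
  r-w-mono {i} {j} i≤j = IsLastArgmax-mono (+-monoʳ-≤ (L * bₖ) i≤j)
    (lastArgmax-IsLastArgmax _ (≤-trans 0<L·bₖ (m≤m+n _ i))) (lastArgmax-IsLastArgmax _ (≤-trans 0<L·bₖ (m≤m+n _ j)))

  w-last : w (bₖ ∸ 1) ≤ w 0 + 1
  w-last = begin
    w (bₖ ∸ 1)                     ≤⟨ proj₂ (IsLastArgmax-mono (+-monoʳ-≤ (L * bₖ) (m∸n≤m bₖ 1))
                                       (lastArgmax-IsLastArgmax _ (≤-trans 0<L·bₖ (m≤m+n _ (bₖ ∸ 1))))
                                       (lastArgmax-IsLastArgmax _ (≤-trans 0<L·bₖ (m≤m+n _ bₖ)))) ⟩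
    O (lastArgmax (L * bₖ + bₖ))   ≡⟨ O-lastArgmax-+bₖ (L * bₖ) ≤-refl ⟩
    O (lastArgmax (L * bₖ)) + 1    ≡⟨ cong (λ n → O (lastArgmax n) + 1) (+-identityʳ (L * bₖ)) ⟨
    w 0 + 1                        ∎
    where open ≤-Reasoning

  L≤⌊a/bₖ⌋ : ∀ a → L * bₖ ≤ a → L ≤ floorDiv a bₖ
  L≤⌊a/bₖ⌋ a L·bₖ≤a with L ≤? floorDiv a bₖ
  ... | yes L≤Q = L≤Q
  ... | no  L≰Q = ⊥-elim (<⇒≱ (begin-strict
    modN a bₖ + floorDiv a bₖ * bₖ   <⟨ +-monoˡ-< (floorDiv a bₖ * bₖ) (modN< a bₖ 0<bₖ) ⟩
    suc (floorDiv a bₖ) * bₖ         ≤⟨ *-monoˡ-≤ bₖ (≰⇒> L≰Q) ⟩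
    L * bₖ                           ∎) (≤-trans L·bₖ≤a (≤-reflexive (modN+floorDiv* a bₖ 0<bₖ))))
    where open ≤-Reasoning

  L·bₖ+j+t·bₖ≡a : ∀ a → L * bₖ ≤ a → L * bₖ + modN a bₖ + (floorDiv a bₖ ∸ L) * bₖ ≡ a
  L·bₖ+j+t·bₖ≡a a L·bₖ≤a = begin
    L * bₖ + j + (Q ∸ L) * bₖ   ≡⟨ regroup L bₖ j (Q ∸ L) ⟩
    j + (L + (Q ∸ L)) * bₖ      ≡⟨ cong (λ q → j + q * bₖ) (m+[n∸m]≡n (L≤⌊a/bₖ⌋ a L·bₖ≤a)) ⟩
    j + Q * bₖ                  ≡⟨ modN+floorDiv* a bₖ 0<bₖ ⟨
    a                           ∎
    where
      open ≡-Reasoning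
      j = modN a bₖ
      Q = floorDiv a bₖ
      regroup : ∀ L B j t → L * B + j + t * B ≡ j + (L + t) * B
      regroup = solve-∀

  frobenius-formula : ∀ h d → 0 < h → d ≤ h * L → ∀ a → L * bₖ ≤ a → gcd a d ≡ 1 →
    IsFrobenius (Aseq b h d a)
      ((ℤ.+ (w (modN a bₖ) * h) ℤ.- ℤ.+ 1) ℤ.* ℤ.+ a ℤ.+ ℤ.+ (r (modN a bₖ) * d)
       ℤ.+ ℤ.+ (h * a + bₖ * d) ℤ.* (ℤ.+ floorDiv a bₖ ℤ.- ℤ.+ L))
  frobenius-formula h d 0<h d≤h·L a L·bₖ≤a gcd≡1 =
    subst (IsFrobenius (Aseq b h d a)) (sym closed-form) frobenius-x
    where
      open FrobeniusOfA b b₀≡1 b-pos h d a using (V; frobenius)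
      j = modN a bₖ
      Q = floorDiv a bₖ
      t = Q ∸ L
      x = lastArgmax a
      x-max = lastArgmax-IsLastArgmax a (≤-trans 0<L·bₖ L·bₖ≤a)
      d·bₖ≤h·a : d * bₖ ≤ h * a
      d·bₖ≤h·a = ≤-trans (*-monoˡ-≤ bₖ d≤h·L) (≤-trans (≤-reflexive (*-assoc h L bₖ)) (*-monoʳ-≤ h L·bₖ≤a))
      frobenius-x : IsFrobenius (Aseq b h d a) (ℤ.+ V x ℤ.- ℤ.+ a)
      frobenius-x = frobenius (gcd≡1⇒coprime gcd≡1) bₖ b≤bₖ x (proj₁ x-max) 0<h
                      (≤-trans 0<L (L≤Ox L·bₖ≤a x-max)) (bₖ·Ox≤x+a L·bₖ≤a x-max)
                      (V≤Vx L·bₖ≤a x-max h d d·bₖ≤h·a)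
      x≡ : x ≡ r j + t * bₖ
      x≡ = trans (cong lastArgmax (sym (L·bₖ+j+t·bₖ≡a a L·bₖ≤a))) (lastArgmax-periodic j t)
      Ox≡ : O x ≡ w j + t
      Ox≡ = trans (cong (λ n → O (lastArgmax n)) (sym (L·bₖ+j+t·bₖ≡a a L·bₖ≤a))) (O-lastArgmax-periodic j t)
      target : ℕ → ℤ.ℤ
      target q = (ℤ.+ (w j * h) ℤ.- ℤ.+ 1) ℤ.* ℤ.+ a ℤ.+ ℤ.+ (r j * d) ℤ.+ ℤ.+ (h * a + bₖ * d) ℤ.* (ℤ.+ q ℤ.- ℤ.+ L)
      closed-form : target Q ≡ ℤ.+ V x ℤ.- ℤ.+ a
      closed-form = begin
        target Q       ≡⟨ cong target (sym (m+[n∸m]≡n (L≤⌊a/bₖ⌋ a L·bₖ≤a))) ⟩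
        target (L + t)
                       ≡⟨ cast-closed-form (w j) h a (r j) d bₖ L t ⟩
        ℤ.+ (h * a * (w j + t) + d * (r j + t * bₖ)) ℤ.- ℤ.+ a
                       ≡⟨ cong₂ (λ o y → ℤ.+ (h * a * o + d * y) ℤ.- ℤ.+ a) Ox≡ x≡ ⟨
        ℤ.+ V x ℤ.- ℤ.+ a ∎
        where open ≡-Reasoning

open import Data.Integer using (+_)

theorem3p3 : (m : ℕ) → (b : Fin (suc (suc m)) → ℕ) →
    b zero ≡ 1 →
    ((i j : Fin (suc (suc m))) → i <ᶠ j → b i < b j) →
    (c : ℕ) → IsMaxOB b (b (fromℕ (suc m))) c → 2 ≤ c →
    (u : ℕ) →
    u ≡ (c ∸ 1) ⊔ ceilDiv ((c ∸ 1) * b (inject₁ (fromℕ m))) (b (fromℕ (suc m)) ∸ b (inject₁ (fromℕ m))) →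
    (h d : ℕ) → 1 ≤ h → 1 ≤ d → ceilDiv d (u + c ∸ 1) ≤ h →
    Σ (ℕ → ℕ) λ w → Σ (ℕ → ℕ) λ r →
      ((a : ℕ) → 1 ≤ a → (u + c ∸ 1) * b (fromℕ (suc m)) ≤ a → gcd a d ≡ 1 →
        IsFrobenius (Aseq b h d a)
          ((+ (w (modN a (b (fromℕ (suc m)))) * h) ℤ.- + 1) ℤ.* + a
           ℤ.+ + (r (modN a (b (fromℕ (suc m)))) * d)
           ℤ.+ + (h * a + b (fromℕ (suc m)) * d)
               ℤ.* (+ floorDiv a (b (fromℕ (suc m))) ℤ.- + (u + c ∸ 1))))
      × ((i j : ℕ) → i ≤ j → j < b (fromℕ (suc m)) → w i ≤ w j)
      × ((i j : ℕ) → i ≤ j → j < b (fromℕ (suc m)) → r i ≤ r j)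
      × (w (b (fromℕ (suc m)) ∸ 1) ≤ w 0 + 1)
theorem3p3 m b b₀≡1 b-strict c c-max 2≤c u u≡ h d 0<h _ ⌈d/L⌉≤h =
  w , r , (λ a _ → frobenius-formula h d 0<h d≤h·L a) ,
  (λ i j i≤j _ → proj₂ (r-w-mono i≤j)) , (λ i j i≤j _ → proj₁ (r-w-mono i≤j)) , w-last
  where
    u-ceil = subst (_ ≤_) (sym u≡) (m≤n⊔m (c ∸ 1) _)
    0<u = ≤-trans (∸-monoˡ-≤ 1 2≤c) (subst (c ∸ 1 ≤_) (sym u≡) (m≤m⊔n (c ∸ 1) _))
    open Setting m b b₀≡1 b-strict c c-max 2≤c u u-ceil 0<u
    d≤h·L = ceilDiv≤⇒≤* d L h 0<L ⌈d/L⌉≤h
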